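{- For every context $\Gamma$ and formula $C$, the recursive definition of $\mathcal{N}(\Gamma\Rightarrow C;\cdot)$ (with the empty vector $\cdot$ of fixpoint declarations) is well-defined, i.e. every sequence of recursive calls starting from $\mathcal{N}(\Gamma\Rightarrow C;\cdot)$ is finite.
   Context: Formulas are built from atoms by implication $\supset$ (associating to the right); every formula is uniquely $A_1\supset\cdots\supset A_n\supset p$ with $p$ an atom. Contexts are finite lists of declarations with distinct variables; $|\Gamma|$ denotes the set of formulas declared in $\Gamma$. A sequent $\sigma$ of the form $\Delta\Rightarrow p$ pairs a context with an atom. Finitary terms of $\overline{\lambda}^{gfp}_{\Sigma}$ (typed-fixpoint version): $N::=\lambda x^A.N\mid\mathrm{gfp}\,X^{\sigma}.(E_1+\cdots+E_n)\mid X^{\sigma}$, $E::=x\langle N_1,\dots,N_k\rangle$, with fixpoint variables $X$ annotated by sequents $\sigma$. Let $\Xi=(X_1:\Theta_1\Rightarrow q_1,\dots,X_m:\Theta_m\Rightarrow q_m)$ be a vector of $m\ge0$ declarations in which no fixpoint variable and no sequent occurs twice. For $C=A_1\supset\cdots\supset A_n\supset p$, put $\Delta:=\Gamma\cup\{z_1:A_1,\dots,z_n:A_n\}$ ($z_i$ fresh) and $\sigma:=(\Delta\Rightarrow p)$. Then $\mathcal{N}(\Gamma\Rightarrow C;\Xi)$ is defined as follows: if for some $1\le i\le m$ we have $p=q_i$, $\Theta_i\subseteq\Gamma$ and $|\Theta_i|=|\Delta|$ (the "if-guard"), then $\mathcal{N}(\Gamma\Rightarrow C;\Xi)=\lambda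 z_1^{A_1}\cdots\lambda z_n^{A_n}.X_i^{\sigma}$; otherwise $\mathcal{N}(\Gamma\Rightarrow C;\Xi)=\lambda z_1^{A_1}\cdots\lambda z_n^{A_n}.\mathrm{gfp}\,Y^{\sigma}.\sum_{(y:B_1\supset\cdots\supset B_k\supset p)\in\Delta}y\langle\mathcal{N}(\Delta\Rightarrow B_1;\Xi,Y:\sigma),\dots,\mathcal{N}(\Delta\Rightarrow B_k;\Xi,Y:\sigma)\rangle$ with $Y$ a fresh fixpoint variable. A recursive call is a step $\mathcal{N}(\Gamma\Rightarrow C;\Xi)\leadsto\mathcal{N}(\Delta\Rightarrow B_j;\Xi,Y:\sigma)$ occurring in the second case, for some $(y:B_1\supset\cdots\supset B_k\supset p)\in\Delta$ and some $j$. -}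

module Defs where

open import Data.Nat using (ℕ)
open import Data.List using (List; []; _∷_; _++_; map; zip; length; [_])
open import Data.List.Membership.Propositional using (_∈_; _∉_)
open import Data.List.Relation.Unary.Unique.Propositional using (Unique)
open import Data.List.Relation.Unary.All using (All)
open import Data.Product using (Σ; ∃; _×_; _,_; proj₁; proj₂)
open import Relation.Nullary using (¬_)
open import Relation.Binary.PropositionalEquality using (_≡_)

Atom : Set
Atom = ℕ

infixr 6 _⊃_
data Form : Set where
  atom : Atom → Form
  _⊃_  : Form → Form → Form

-- Every formula is uniquely A₁ ⊃ ⋯ ⊃ Aₙ ⊃ p.
args : Form → List Form
args (atom p) = []
args (A ⊃ B)  = A ∷ args B

hd : Form → Atom
hd (atom p) = p
hd (A ⊃ B)  = hd B

Var : Set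
Var = ℕ

Context : Set
Context = List (Var × Form)

vars : Context → List Var
vars = map proj₁

-- |Γ| : the formulas declared in Γ (as a list, compared as sets)
forms : Context → List Form
forms = map proj₂

ValidContext : Context → Set
ValidContext Γ = Unique (vars Γ)

_⊆ctx_ : Context → Context → Set
Θ ⊆ctx Γ = ∀ {d} → d ∈ Θ → d ∈ Γ

SameForms : Context → Context → Set
SameForms Θ Δ = ∀ A → (A ∈ forms Θ → A ∈ forms Δ) × (A ∈ forms Δ → A ∈ forms Θ)

record Sequent : Set where
  constructor _⇒_
  field
    ctx  : Context
    goal : Atom
open Sequent public

FVar : Set
FVar = ℕ

FixDecls : Set
FixDecls = List (FVar × Sequent)

-- A state of the recursion: the arguments of a call 𝒩(Γ ⇒ C; Ξ).
State : Set
State = Context × Form × FixDecls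

-- The if-guard for 𝒩(Γ ⇒ C; Ξ), with Δ the extended context.
Guard : Context → Context → Atom → FixDecls → Set
Guard Γ Δ p Ξ =
  Σ FVar λ X → Σ Context λ Θ → Σ Atom λ q →
    ((X , (Θ ⇒ q)) ∈ Ξ) × (p ≡ q) × (Θ ⊆ctx Γ) × SameForms Θ Δ

-- Recursive call relation: s ⇝ t means the computation of 𝒩(s) makes the
-- recursive call 𝒩(t) (for some admissible choice of fresh z₁…zₙ and Y).
record _⇝_ (s t : State) : Set where
  field
    zs        : List Var
    zs-length : length zs ≡ length (args (proj₁ (proj₂ s)))
    zs-unique : Unique zs
    zs-fresh  : All (λ z → z ∉ vars (proj₁ s)) zs
    no-guard  : ¬ Guard (proj₁ s)
                        (proj₁ s ++ zip zs (args (proj₁ (proj₂ s))))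
                        (hd (proj₁ (proj₂ s)))
                        (proj₂ (proj₂ s))
    Y         : FVar
    Y-fresh   : Y ∉ map proj₁ (proj₂ (proj₂ s))
    y         : Var
    D         : Form
    yD∈Δ      : (y , D) ∈ (proj₁ s ++ zip zs (args (proj₁ (proj₂ s))))
    hd-D      : hd D ≡ hd (proj₁ (proj₂ s))
    B         : Form
    B∈args    : B ∈ args D
    target    : t ≡ ( proj₁ s ++ zip zs (args (proj₁ (proj₂ s)))
                    , B
                    , proj₂ (proj₂ s) ++
                        [ (Y , ((proj₁ s ++ zip zs (args (proj₁ (proj₂ s))))
                                ⇒ hd (proj₁ (proj₂ s)))) ] )

-- converse relation, so that accessibility = no infinite call sequence
_⇜_ : State → State → Set
t ⇜ s = s ⇝ t

module Submission where

open import Defs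
open import Data.List using ([])
open import Data.Product using (_,_)
open import Induction.WellFounded using (Acc)

open import Function using (_∘_)
open import Data.Nat using (ℕ; _≤_; _<_) renaming (_≟_ to _≟ℕ_)
open import Data.Nat.Properties using (≤∧≢⇒<)
open import Data.Nat.Induction using (<-wellFounded)
open import Data.List using (List; _∷_; _++_; map; zip; filter; length; concatMap; [_])
open import Data.List.Properties using (map-++; filter-≐)
open import Data.List.Membership.Propositional using (_∈_; _∉_; find)
open import Data.List.Membership.Propositional.Properties
  using (∈-++⁺ˡ; ∈-++⁺ʳ; ∈-++⁻; ∈-map⁺; ∈-filter⁺; ∈-filter⁻; ∈-concatMap⁺; ∈-concatMap⁻)
open import Data.List.Relation.Binary.Subset.Propositional using (_⊆_)
open import Data.List.Relation.Binary.Subset.Propositional.Properties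
  using (⊆-refl; ⊆-trans; ⊆-reflexive; xs⊆xs++ys; xs⊆x∷xs; ++⁺; map⁺)
open import Data.List.Relation.Binary.Sublist.Propositional
  using () renaming (_⊆_ to _⊑_; ⊆-refl to ⊑-refl)
import Data.List.Relation.Binary.Sublist.Propositional.Properties as Sublist
open import Data.List.Relation.Binary.Equality.Propositional using (≋⇒≡)
open import Data.List.Relation.Unary.Any as Any using (Any; here; there; any?)
open import Data.List.Relation.Unary.Any.Properties using (++⁺ˡ; ++⁺ʳ)
open import Data.List.Relation.Unary.All as All using (all?)
open import Data.List.Relation.Unary.All.Properties using (¬All⇒Any¬)
open import Data.Product using (_×_; proj₂)
open import Data.Product.Relation.Binary.Lex.Strict using (×-Lex; ×-wellFounded)
open import Data.Sum using (inj₁; inj₂; [_,_]′)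
open import Relation.Nullary using (¬_; Dec; yes; no)
open import Relation.Nullary.Decidable using (_×-dec_; ¬?)
open import Relation.Binary.Core using (Rel)
open import Relation.Binary.Definitions using (DecidableEquality)
open import Relation.Binary.PropositionalEquality using (_≡_; refl; sym; cong; subst)
open import Relation.Unary using (Pred; Decidable)
open import Induction.WellFounded using (acc; WellFounded)

-- Every formula declared in a context and every goal of the recursion is a
-- subformula of C or of a formula of Γ, so lies in a fixed finite list U.
-- Along a recursive call |Γ| can only grow. If it grows strictly, fewer
-- formulas of U are undeclared. If not, the failed if-guard shows that no
-- declaration of Ξ covered the atom p with the formulas |Γ|, while the new
-- declaration Y : Δ ⇒ p does; so fewer heads of formulas of U are uncovered.
-- Hence the pair of these two counts decreases lexicographically.

_≟ᶠ_ : DecidableEquality Form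
atom p ≟ᶠ atom q with p ≟ℕ q
... | yes refl = yes refl
... | no p≢q   = no λ { refl → p≢q refl }
atom _ ≟ᶠ (_ ⊃ _) = no λ ()
(_ ⊃ _) ≟ᶠ atom _ = no λ ()
(A ⊃ B) ≟ᶠ (A′ ⊃ B′) with A ≟ᶠ A′ | B ≟ᶠ B′
... | yes refl | yes refl = yes refl
... | no A≢A′  | _        = no λ { refl → A≢A′ refl }
... | yes _    | no B≢B′  = no λ { refl → B≢B′ refl }

open import Data.List.Membership.DecPropositional _≟ᶠ_ using (_∈?_)
open import Data.List.Relation.Binary.Subset.DecPropositional _≟ᶠ_ using (_⊆?_)

subformulas : Form → List Form
subformulas (atom p) = [ atom p ]
subformulas (A ⊃ B)  = A ⊃ B ∷ subformulas A ++ subformulas B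

self∈subformulas : ∀ A → A ∈ subformulas A
self∈subformulas (atom p) = here refl
self∈subformulas (A ⊃ B)  = here refl

subformulas-trans : ∀ {A B} → B ∈ subformulas A → subformulas B ⊆ subformulas A
subformulas-trans {atom p} (here refl) C∈ = C∈
subformulas-trans {A ⊃ B} (here refl) C∈ = C∈
subformulas-trans {A ⊃ B} (there k) C∈ with ∈-++⁻ (subformulas A) k
... | inj₁ k′ = there (∈-++⁺ˡ (subformulas-trans k′ C∈))
... | inj₂ k′ = there (∈-++⁺ʳ (subformulas A) (subformulas-trans k′ C∈))

args⊆subformulas : ∀ A → args A ⊆ subformulas A
args⊆subformulas (A ⊃ B) (here refl) = there (∈-++⁺ˡ (self∈subformulas A))
args⊆subformulas (A ⊃ B) (there k)   = there (∈-++⁺ʳ (subformulas A) (args⊆subformulas B k))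

ArgsClosed : List Form → Set
ArgsClosed U = ∀ {D} → D ∈ U → args D ⊆ U

⊆concatMap-subformulas : ∀ L → L ⊆ concatMap subformulas L
⊆concatMap-subformulas L A∈ =
  ∈-concatMap⁺ subformulas (Any.map (λ { refl → self∈subformulas _ }) A∈)

concatMap-subformulas-closed : ∀ L → ArgsClosed (concatMap subformulas L)
concatMap-subformulas-closed L {D} D∈ B∈ =
  ∈-concatMap⁺ subformulas
    (Any.map (λ D∈E → subformulas-trans D∈E (args⊆subformulas D B∈))
             (∈-concatMap⁻ subformulas {xs = L} D∈))

module _ {a p q} {A : Set a} {P : Pred A p} {Q : Pred A q}
         (P? : Decidable P) (Q? : Decidable Q) (P⇒Q : ∀ {x} → P x → Q x) where

  filter-⊑ : ∀ xs → filter P? xs ⊑ filter Q? xs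
  filter-⊑ xs = Sublist.filter⁺ P? Q? (λ { refl → P⇒Q }) (⊑-refl {x = xs})

  length-filter-mono-≤ : ∀ xs → length (filter P? xs) ≤ length (filter Q? xs)
  length-filter-mono-≤ xs = Sublist.length-mono-≤ (filter-⊑ xs)

  -- A sublist of the same length is the whole list.
  length-filter-mono-< : ∀ {x xs} → x ∈ xs → Q x → ¬ P x →
                         length (filter P? xs) < length (filter Q? xs)
  length-filter-mono-< {x} {xs} x∈xs Qx ¬Px = ≤∧≢⇒< (length-filter-mono-≤ xs) lengths-differ
    where
    lengths-differ : ¬ length (filter P? xs) ≡ length (filter Q? xs)
    lengths-differ eq = ¬Px (proj₂ (∈-filter⁻ P? {xs = xs} x∈filter-P))
      where
      x∈filter-P : x ∈ filter P? xs
      x∈filter-P = subst (x ∈_) (sym (≋⇒≡ (Sublist.to-≋ eq (filter-⊑ xs))))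
                             (∈-filter⁺ Q? x∈xs Qx)

accessible-by-measure : ∀ {a b ℓ₁ ℓ₂ i} {A : Set a} {B : Set b}
                        {_⊏_ : Rel A ℓ₁} {_<_ : Rel B ℓ₂} {I : Pred A i} →
                        WellFounded _<_ → (μ : A → B) →
                        (∀ {s t} → I s → t ⊏ s → I t × μ t < μ s) →
                        ∀ {s} → I s → Acc _⊏_ s
accessible-by-measure {_⊏_ = _⊏_} {_<_} {I} wf μ step {s} = go (wf (μ s))
  where
  go : ∀ {s} → Acc _<_ (μ s) → I s → Acc _⊏_ s
  go (acc rec) Is = acc λ t⊏s → let It , μt<μs = step Is t⊏s in go (rec μt<μs) It

forms-zip : ∀ (zs : List Var) As → forms (zip zs As) ⊆ As
forms-zip (z ∷ zs) (A ∷ As) (here x≡A) = here x≡A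
forms-zip (z ∷ zs) (A ∷ As) (there k)  = there (forms-zip zs As k)

forms-++-zip : ∀ Γ zs As → forms (Γ ++ zip zs As) ⊆ forms Γ ++ As
forms-++-zip Γ zs As =
  ⊆-trans (⊆-reflexive (map-++ proj₂ Γ (zip zs As))) (++⁺ ⊆-refl (forms-zip zs As))

SameSet : List Form → List Form → Set
SameSet Φ Ψ = Φ ⊆ Ψ × Ψ ⊆ Φ

sameSet? : ∀ Φ Ψ → Dec (SameSet Φ Ψ)
sameSet? Φ Ψ = Φ ⊆? Ψ ×-dec Ψ ⊆? Φ

Covers : List Form → Atom → FVar × Sequent → Set
Covers Φ p (_ , (Θ ⇒ q)) = q ≡ p × SameSet (forms Θ) Φ

-- Covered Ξ |Δ| p is the if-guard with the condition Θ ⊆ Γ dropped.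
Covered : FixDecls → List Form → Atom → Set
Covered Ξ Φ p = Any (Covers Φ p) Ξ

covered? : ∀ Ξ Φ p → Dec (Covered Ξ Φ p)
covered? Ξ Φ p = any? (λ (_ , (Θ ⇒ q)) → q ≟ℕ p ×-dec sameSet? (forms Θ) Φ) Ξ

Covered-resp-SameSet : ∀ {Ξ Φ Ψ p} → SameSet Φ Ψ → Covered Ξ Φ p → Covered Ξ Ψ p
Covered-resp-SameSet (Φ⊆Ψ , Ψ⊆Φ) =
  Any.map λ (q≡p , Θ⊆Φ , Φ⊆Θ) → q≡p , ⊆-trans Θ⊆Φ Φ⊆Ψ , ⊆-trans Ψ⊆Φ Φ⊆Θ

¬Guard⇒¬Covered : ∀ {Γ Δ p Ξ} → (∀ {X σ} → (X , σ) ∈ Ξ → ctx σ ⊆ctx Γ) →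
                  ¬ Guard Γ Δ p Ξ → ¬ Covered Ξ (forms Δ) p
¬Guard⇒¬Covered Ξ⊆Γ ¬guard covered with find covered
... | (X , (Θ ⇒ q)) , decl∈Ξ , (q≡p , Θ⊆Δ , Δ⊆Θ) =
  ¬guard (X , Θ , q , decl∈Ξ , sym q≡p , Ξ⊆Γ decl∈Ξ , λ _ → Θ⊆Δ , Δ⊆Θ)

module Termination (U : List Form) (U-closed : ArgsClosed U) where

  Invariant : State → Set
  Invariant (Γ , C , Ξ) =
    forms Γ ⊆ U × C ∈ U × (∀ {X σ} → (X , σ) ∈ Ξ → ctx σ ⊆ctx Γ)

  unused : Context → ℕ
  unused Γ = length (filter (λ A → ¬? (A ∈? forms Γ)) U)

  uncovered : Context → FixDecls → ℕ
  uncovered Γ Ξ = length (filter (λ p → ¬? (covered? Ξ (forms Γ) p)) (map hd U))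

  measure : State → ℕ × ℕ
  measure (Γ , _ , Ξ) = unused Γ , uncovered Γ Ξ

  _<ₗₑₓ_ : ℕ × ℕ → ℕ × ℕ → Set
  _<ₗₑₓ_ = ×-Lex _≡_ _<_ _<_

  unused-< : ∀ {Γ Δ A} → forms Γ ⊆ forms Δ → A ∈ U → A ∈ forms Δ → A ∉ forms Γ →
             unused Δ < unused Γ
  unused-< {Γ} {Δ} Γ⊆Δ A∈U A∈Δ A∉Γ =
    length-filter-mono-< (λ A → ¬? (A ∈? forms Δ)) (λ A → ¬? (A ∈? forms Γ))
      (λ A∉Δ → A∉Δ ∘ Γ⊆Δ) A∈U A∉Γ (λ A∉Δ → A∉Δ A∈Δ)

  unused-cong : ∀ {Γ Δ} → SameSet (forms Γ) (forms Δ) → unused Δ ≡ unused Γ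
  unused-cong {Γ} {Δ} (Γ⊆Δ , Δ⊆Γ) =
    cong length (filter-≐ (λ A → ¬? (A ∈? forms Δ)) (λ A → ¬? (A ∈? forms Γ))
                          ((λ A∉Δ → A∉Δ ∘ Γ⊆Δ) , (λ A∉Γ → A∉Γ ∘ Δ⊆Γ)) U)

  uncovered-< : ∀ {Γ Δ Ξ Ξ′ p} → SameSet (forms Γ) (forms Δ) → p ∈ map hd U →
                ¬ Covered Ξ (forms Γ) p → Covered Ξ′ (forms Δ) p →
                uncovered Δ (Ξ ++ Ξ′) < uncovered Γ Ξ
  uncovered-< {Γ} {Δ} {Ξ} {Ξ′} Γ≈Δ p∈U ¬covered covered′ =
    length-filter-mono-< (λ q → ¬? (covered? (Ξ ++ Ξ′) (forms Δ) q))
                         (λ q → ¬? (covered? Ξ (forms Γ) q))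
      (λ ¬covered-Δ covered-Γ → ¬covered-Δ (++⁺ˡ (Covered-resp-SameSet Γ≈Δ covered-Γ)))
      p∈U ¬covered (λ ¬covered′ → ¬covered′ (++⁺ʳ Ξ covered′))

  ⇝-decreasing : ∀ {s t} → Invariant s → s ⇝ t → Invariant t × measure t <ₗₑₓ measure s
  ⇝-decreasing {Γ , C , Ξ} (Γ⊆U , C∈U , Ξ⊆Γ)
    record { zs = zs ; no-guard = ¬guard ; Y = Y ; yD∈Δ = yD∈Δ ; B = B ; B∈args = B∈D ; target = refl }
    = (Δ⊆U , U-closed (Δ⊆U (∈-map⁺ proj₂ yD∈Δ)) B∈D , Ξ′⊆Δ) , decrease
    where
    Δ : Context
    Δ = Γ ++ zip zs (args C)

    Γ⊆Δ : forms Γ ⊆ forms Δ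
    Γ⊆Δ = map⁺ proj₂ (xs⊆xs++ys Γ _)

    Δ⊆U : forms Δ ⊆ U
    Δ⊆U A∈Δ = [ Γ⊆U , U-closed C∈U ]′ (∈-++⁻ (forms Γ) (forms-++-zip Γ zs (args C) A∈Δ))

    Ξ′⊆Δ : ∀ {X σ} → (X , σ) ∈ Ξ ++ [ Y , (Δ ⇒ hd C) ] → ctx σ ⊆ctx Δ
    Ξ′⊆Δ decl∈ with ∈-++⁻ Ξ decl∈
    ... | inj₁ decl∈Ξ      = ∈-++⁺ˡ ∘ Ξ⊆Γ decl∈Ξ
    ... | inj₂ (here refl) = λ d∈Δ → d∈Δ

    -- Either Δ declares a new formula, or the new fixpoint variable covers hd C
    -- in a context with the formulas of Γ, which no declaration of Ξ did.
    decrease : measure (Δ , B , Ξ ++ [ Y , (Δ ⇒ hd C) ]) <ₗₑₓ measure (Γ , C , Ξ)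
    decrease with all? (_∈? forms Γ) (forms Δ)
    ... | no Δ⊈Γ =
      let A , A∈Δ , A∉Γ = find (¬All⇒Any¬ (_∈? forms Γ) (forms Δ) Δ⊈Γ)
      in inj₁ (unused-< Γ⊆Δ (Δ⊆U A∈Δ) A∈Δ A∉Γ)
    ... | yes Δ⊆Γ = inj₂ (unused-cong Γ≈Δ , uncovered-< Γ≈Δ (∈-map⁺ hd C∈U) ¬covered new-covers)
      where
      Γ≈Δ : SameSet (forms Γ) (forms Δ)
      Γ≈Δ = Γ⊆Δ , All.lookup Δ⊆Γ

      ¬covered : ¬ Covered Ξ (forms Γ) (hd C)
      ¬covered = ¬Guard⇒¬Covered Ξ⊆Γ ¬guard ∘ Covered-resp-SameSet Γ≈Δ

      new-covers : Covered [ Y , (Δ ⇒ hd C) ] (forms Δ) (hd C)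
      new-covers = here (refl , ⊆-refl , ⊆-refl)

lemma24 : (Γ : Context) → ValidContext Γ → (C : Form) → Acc _⇜_ (Γ , C , [])
lemma24 Γ _ C =
  accessible-by-measure (×-wellFounded <-wellFounded <-wellFounded) measure ⇝-decreasing
    (⊆-trans (xs⊆x∷xs (forms Γ) C) (⊆concatMap-subformulas L) ,
     ⊆concatMap-subformulas L (here refl) ,
     λ ())
  where
  L : List Form
  L = C ∷ forms Γ

  open Termination (concatMap subformulas L) (concatMap-subformulas-closed L)
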